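{- (Unique Triangle) Let $G=(V,E)$ be an undirected graph, let $\mathsf{APX}$ be a triangle-free 2-matching of $G$ and let $\mathsf{OPT}$ be a maximum-cardinality triangle-free 2-matching of $G$ maximizing $|\mathsf{APX}\cap\mathsf{OPT}|$. Let $k\geq1$ and let $P_1,\ldots,P_{k-1}$ be a (possibly empty) collection of pairwise edge-disjoint augmenting trails for $\mathsf{APX}$, all contained in $\mathsf{APX}\triangle\mathsf{OPT}$, and let $\mathcal{P}_{j}:=\bigcup_{i=1}^{j}P_i$. Let $P_k$ be an alternating trail (w.r.t. $\mathsf{APX}$) contained in $(\mathsf{APX}\triangle\mathsf{OPT})\setminus\mathcal{P}_{k-1}$, whose first edge belongs to $\mathsf{OPT}\setminus\mathsf{APX}$ and whose first node is deficient w.r.t. $\mathcal{P}_{k-1}$. Then every edge $uv\in P_k$ belongs to at most one triangle of the graph $(V,\mathsf{APX}\triangle P_k)$ and to at most one triangle of the graph $(V,\mathsf{OPT}\triangle\mathcal{P}_k)$.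
   Context: A 2-matching of $G$ is a set $M\subseteq E$ with each node incident to at most two edges of $M$; it is triangle-free if $(V,M)$ has no triangle. For $S\subseteq E$, $N_S(u)$ is the set of neighbors of $u$ in $(V,S)$. A trail is a sequence of distinct consecutive edges $u_1u_2,\ldots,u_{m-1}u_m$ (nodes may repeat), with first node $u_1$ and last node $u_m$; it is identified with its edge set when taking unions and symmetric differences $\triangle$. A trail is alternating w.r.t. $\mathsf{APX}$ if no two consecutive edges are both in $\mathsf{APX}$ or both outside $\mathsf{APX}$. An alternating trail $P$ is augmenting for $\mathsf{APX}$ if $\mathsf{APX}\triangle P$ is a triangle-free 2-matching of size $|\mathsf{APX}|+1$. For $E'\subseteq E$, a node $u$ is deficient w.r.t. $E'$ if $|N_{\mathsf{APX}\setminus E'}(u)|<|N_{\mathsf{OPT}\setminus E'}(u)|$. -}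

module Defs where

open import Data.Nat using (ℕ; zero; suc; _≤_; _<_)
open import Data.Fin using (Fin; zero; suc; toℕ; inject₁)
open import Data.Fin.Properties using (any?) renaming (_≟_ to _≟ᶠ_)
open import Data.Fin.Subset using (Subset; _∈_; _⊆_; _∩_; _∪_; _─_; ∣_∣; ⊥)
open import Data.Fin.Subset.Properties using (_∈?_)
open import Data.Vec using (tabulate; lookup)
open import Data.Product using (Σ; ∃; _×_; _,_; Σ-syntax)
open import Data.Product.Properties using () 
open import Data.Sum using (_⊎_)
open import Relation.Nullary using (¬_; Dec)
open import Relation.Nullary.Decidable using (⌊_⌋; _×-dec_; _⊎-dec_)
open import Relation.Binary.PropositionalEquality using (_≡_; _≢_)
open import Function.Definitions using (Injective)

-- A finite simple undirected graph with vertex set Fin n and edge set Fin m;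
-- edge e has endpoints src e and tgt e (orientation irrelevant).
record Graph (n m : ℕ) : Set where
  field
    src tgt  : Fin m → Fin n
    loopless : ∀ e → src e ≢ tgt e

  Joins : Fin m → Fin n → Fin n → Set
  Joins e u v = (src e ≡ u × tgt e ≡ v) ⊎ (src e ≡ v × tgt e ≡ u)

  field
    simple : ∀ e e' u v → Joins e u v → Joins e' u v → e ≡ e'

  joins? : ∀ e u v → Dec (Joins e u v)
  joins? e u v = ((src e ≟ᶠ u) ×-dec (tgt e ≟ᶠ v)) ⊎-dec ((src e ≟ᶠ v) ×-dec (tgt e ≟ᶠ u))

  incident : Subset m → Fin n → Subset m
  incident S u = tabulate λ e → ⌊ (e ∈? S) ×-dec ((src e ≟ᶠ u) ⊎-dec (tgt e ≟ᶠ u)) ⌋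

  N : Subset m → Fin n → Subset n
  N S u = tabulate λ v → ⌊ any? (λ e → (e ∈? S) ×-dec joins? e u v) ⌋

  Adj : Subset m → Fin n → Fin n → Set
  Adj S u v = Σ[ e ∈ Fin m ] (e ∈ S × Joins e u v)

  IsTriangle : Subset m → Fin n → Fin n → Fin n → Set
  IsTriangle S a b c = a ≢ b × b ≢ c × a ≢ c × Adj S a b × Adj S b c × Adj S a c

  TriangleFree : Subset m → Set
  TriangleFree S = ∀ a b c → ¬ IsTriangle S a b c

  Is2Matching : Subset m → Set
  Is2Matching M = ∀ u → ∣ incident M u ∣ ≤ 2

  IsTF2M : Subset m → Set
  IsTF2M M = Is2Matching M × TriangleFree M

  AtMostOneTriangle : Subset m → Fin m → Set
  AtMostOneTriangle S e =
    ∀ w w' → IsTriangle S (src e) (tgt e) w → IsTriangle S (src e) (tgt e) w' → w ≡ w'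

_△_ : ∀ {m} → Subset m → Subset m → Subset m
S △ T = (S ─ T) ∪ (T ─ S)

Disjoint : ∀ {m} → Subset m → Subset m → Set
Disjoint S T = ∀ e → ¬ (e ∈ S × e ∈ T)

⋃ : ∀ {m j} → (Fin j → Subset m) → Subset m
⋃ {j = zero}  F = ⊥
⋃ {j = suc j} F = F zero ∪ ⋃ (λ i → F (suc i))

module _ {n m : ℕ} (G : Graph n m) where
  open Graph G

  record Trail : Set where
    field
      len      : ℕ
      edge     : Fin len → Fin m
      node     : Fin (suc len) → Fin n
      consec   : ∀ i → Joins (edge i) (node (inject₁ i)) (node (suc i))
      distinct : Injective _≡_ _≡_ edge

  open Trail public

  edges : Trail → Subset m
  edges P = tabulate λ e → ⌊ any? (λ i → edge P i ≟ᶠ e) ⌋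

  firstNode : Trail → Fin n
  firstNode P = node P zero

  FirstEdgeIn : Trail → Subset m → Set
  FirstEdgeIn P S = 0 < len P × (∀ i → toℕ i ≡ 0 → edge P i ∈ S)

  Alternating : Subset m → Trail → Set
  Alternating A P = ∀ i j → suc (toℕ i) ≡ toℕ j →
    (edge P i ∈ A → ¬ edge P j ∈ A) × (¬ edge P i ∈ A → edge P j ∈ A)

  Augmenting : Subset m → Trail → Set
  Augmenting A P = Alternating A P × IsTF2M (A △ edges P) × ∣ A △ edges P ∣ ≡ suc ∣ A ∣

  Deficient : Subset m → Subset m → Subset m → Fin n → Set
  Deficient APX OPT E' u = ∣ N (APX ─ E') u ∣ < ∣ N (OPT ─ E') u ∣

  OptFor : Subset m → Subset m → Set
  OptFor APX OPT = IsTF2M OPT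
    × (∀ M → IsTF2M M → ∣ M ∣ ≤ ∣ OPT ∣)
    × (∀ M → IsTF2M M → ∣ M ∣ ≡ ∣ OPT ∣ → ∣ APX ∩ M ∣ ≤ ∣ APX ∩ OPT ∣)

{-# OPTIONS --safe #-}
module Submission where

-- Let ℓ be the last node of P_k. Every node z ≠ ℓ has degree at most 2 in APX △ P_k and in
-- OPT △ 𝒫_k, and an edge lying in two triangles needs both endpoints of degree at least 3.
-- At z, an edge added by the symmetric difference is paired, inside its own alternating trail,
-- with the consecutive edge through z, which is removed; this injects the new edges at z into the
-- old ones (the trail ends at z belong to the base matching, since augmenting trails start and
-- end outside APX). The one exception is the first edge of P_k at its first node u; it is paid
-- for by deficiency: counting neighbours outside 𝒫_{k-1} and pairing the APX-edges inside
-- 𝒫_{k-1} with OPT-edges shows that u has at most one APX-edge.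

open import Defs
open import Data.Nat using (ℕ; suc; _+_; _≤_; _<_; z≤n; s≤s; s≤s⁻¹)
open import Data.Nat.Properties
  using (suc-injective; ≤-trans; ≤-antisym; ≤-reflexive; 1+n≰n; +-suc;
         +-mono-≤; +-monoʳ-≤; +-monoˡ-≤; +-monoʳ-<; module ≤-Reasoning)
open import Data.Fin using (Fin; zero; suc; toℕ; inject₁; fromℕ; fromℕ<)
open import Data.Fin.Properties using (any?; toℕ-injective; toℕ-inject₁; toℕ-fromℕ; toℕ-fromℕ<)
  renaming (_≟_ to _≟ᶠ_; suc-injective to fsuc-injective)
open import Data.Fin.Subset using (Subset; _∈_; _∉_; _⊆_; _∩_; _∪_; _─_; _-_; ∣_∣; ⁅_⁆; inside; outside)
  renaming (⊥ to ∅)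
open import Data.Fin.Subset.Properties
  using (_∈?_; x∈p∪q⁺; x∈p∪q⁻; x∈p∩q⁺; x∈p∩q⁻; x∈p∧x∉q⇒x∈p─q; x∈p∧x≢y⇒x∈p-y; x∈p⇒∣p-x∣<∣p∣;
         ∣p∣≤∣x∷p∣; ∉⊥; x∈⁅x⁆; ⊆-antisym; ∣⁅x⁆∣≡1; ∪-identityʳ)
open import Data.Product using (Σ-syntax; ∃-syntax; _×_; _,_; proj₁; proj₂)
open import Data.Sum using (_⊎_; inj₁; inj₂; [_,_])
import Data.Sum as Sum
open import Data.Unit using (⊤; tt)
open import Data.Empty using (⊥-elim)
open import Data.Vec using ([]; _∷_; tabulate; here; there)
open import Data.Vec.Properties using (lookup∘tabulate; []=⇒lookup; lookup⇒[]=)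
open import Function using (_∘_)
open import Relation.Nullary using (¬_; Dec; yes; no; contradiction)
open import Relation.Nullary.Decidable
  using (⌊_⌋; isYes≗does; dec-true; decidable-stable; _×-dec_; _⊎-dec_)
open import Relation.Binary.PropositionalEquality
  using (_≡_; _≢_; refl; sym; trans; cong; cong₂; subst; subst₂; module ≡-Reasoning)

∈tabulate⁺ : ∀ {m} {P : Fin m → Set} (P? : ∀ x → Dec (P x)) {x} → P x → x ∈ tabulate (λ y → ⌊ P? y ⌋)
∈tabulate⁺ P? {x} px =
  lookup⇒[]= x _ (trans (lookup∘tabulate _ x) (trans (isYes≗does (P? x)) (dec-true (P? x) px)))

∈tabulate⁻ : ∀ {m} {P : Fin m → Set} (P? : ∀ x → Dec (P x)) {x} → x ∈ tabulate (λ y → ⌊ P? y ⌋) → P x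
∈tabulate⁻ P? {x} x∈ with P? x | trans (sym (lookup∘tabulate _ x)) ([]=⇒lookup x∈)
... | yes px | _ = px
... | no _   | ()

x∈p─q⁻ : ∀ {m} (p q : Subset m) {x} → x ∈ p ─ q → x ∈ p × x ∉ q
x∈p─q⁻ (inside ∷ p)  (outside ∷ q) here       = here , λ ()
x∈p─q⁻ (inside ∷ p)  (inside ∷ q)  {zero} ()
x∈p─q⁻ (outside ∷ p) (inside ∷ q)  {zero} ()
x∈p─q⁻ (outside ∷ p) (outside ∷ q) {zero} ()
x∈p─q⁻ (_ ∷ p)       (_ ∷ q)       (there x∈) =
  there (proj₁ (x∈p─q⁻ p q x∈)) , λ { (there x∈q) → proj₂ (x∈p─q⁻ p q x∈) x∈q }

x∈p△q⁻ : ∀ {m} (p q : Subset m) {x} → x ∈ p △ q → (x ∈ p × x ∉ q) ⊎ (x ∈ q × x ∉ p)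
x∈p△q⁻ p q x∈ = Sum.map (x∈p─q⁻ p q) (x∈p─q⁻ q p) (x∈p∪q⁻ (p ─ q) (q ─ p) x∈)

module _ {m} {p q : Subset m} {x : Fin m} (x∈p△q : x ∈ p △ q) where

  x∈p△q∧x∉p⇒x∈q : x ∉ p → x ∈ q
  x∈p△q∧x∉p⇒x∈q x∉p = [ (λ (x∈p , _) → contradiction x∈p x∉p) , proj₁ ] (x∈p△q⁻ p q x∈p△q)

  x∈p△q∧x∉q⇒x∈p : x ∉ q → x ∈ p
  x∈p△q∧x∉q⇒x∈p x∉q = [ proj₁ , (λ (x∈q , _) → contradiction x∈q x∉q) ] (x∈p△q⁻ p q x∈p△q)

  x∈p△q∧x∈p⇒x∉q : x ∈ p → x ∉ q
  x∈p△q∧x∈p⇒x∉q x∈p = [ proj₂ , (λ (_ , x∉p) → contradiction x∈p x∉p) ] (x∈p△q⁻ p q x∈p△q)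

  x∈p△q∧x∈q⇒x∉p : x ∈ q → x ∉ p
  x∈p△q∧x∈q⇒x∉p x∈q = [ (λ (_ , x∉q) → contradiction x∈q x∉q) , proj₂ ] (x∈p△q⁻ p q x∈p△q)

∣p∣≡∣p∩q∣+∣p─q∣ : ∀ {m} (p q : Subset m) → ∣ p ∣ ≡ ∣ p ∩ q ∣ + ∣ p ─ q ∣
∣p∣≡∣p∩q∣+∣p─q∣ []            []            = refl
∣p∣≡∣p∩q∣+∣p─q∣ (outside ∷ p) (inside ∷ q)  = ∣p∣≡∣p∩q∣+∣p─q∣ p q
∣p∣≡∣p∩q∣+∣p─q∣ (outside ∷ p) (outside ∷ q) = ∣p∣≡∣p∩q∣+∣p─q∣ p q
∣p∣≡∣p∩q∣+∣p─q∣ (inside ∷ p)  (inside ∷ q)  = cong suc (∣p∣≡∣p∩q∣+∣p─q∣ p q)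
∣p∣≡∣p∩q∣+∣p─q∣ (inside ∷ p)  (outside ∷ q) =
  trans (cong suc (∣p∣≡∣p∩q∣+∣p─q∣ p q)) (sym (+-suc ∣ p ∩ q ∣ ∣ p ─ q ∣))

∣p∪q∣≤∣p∣+∣q∣ : ∀ {m} (p q : Subset m) → ∣ p ∪ q ∣ ≤ ∣ p ∣ + ∣ q ∣
∣p∪q∣≤∣p∣+∣q∣ []            []            = z≤n
∣p∪q∣≤∣p∣+∣q∣ (outside ∷ p) (outside ∷ q) = ∣p∪q∣≤∣p∣+∣q∣ p q
∣p∪q∣≤∣p∣+∣q∣ (outside ∷ p) (inside ∷ q)  =
  ≤-trans (s≤s (∣p∪q∣≤∣p∣+∣q∣ p q)) (≤-reflexive (sym (+-suc ∣ p ∣ ∣ q ∣)))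
∣p∪q∣≤∣p∣+∣q∣ (inside ∷ p)  (t ∷ q)       =
  s≤s (≤-trans (∣p∪q∣≤∣p∣+∣q∣ p q) (+-monoʳ-≤ ∣ p ∣ (∣p∣≤∣x∷p∣ t q)))

distinct³⇒3≤∣p∣ : ∀ {m} {p : Subset m} {a b c} → a ≢ b → b ≢ c → a ≢ c →
  a ∈ p → b ∈ p → c ∈ p → 3 ≤ ∣ p ∣
distinct³⇒3≤∣p∣ {p = p} {a} {b} {c} a≢b b≢c a≢c a∈p b∈p c∈p =
  ≤-trans (s≤s 2≤∣p-a∣) (x∈p⇒∣p-x∣<∣p∣ a∈p)
  where
  b∈p-a : b ∈ p - a
  b∈p-a = x∈p∧x≢y⇒x∈p-y b∈p (λ b≡a → a≢b (sym b≡a))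
  c∈p-a-b : c ∈ p - a - b
  c∈p-a-b = x∈p∧x≢y⇒x∈p-y (x∈p∧x≢y⇒x∈p-y c∈p (λ c≡a → a≢c (sym c≡a))) (λ c≡b → b≢c (sym c≡b))
  2≤∣p-a∣ : 2 ≤ ∣ p - a ∣
  2≤∣p-a∣ = ≤-trans (s≤s (≤-trans (s≤s z≤n) (x∈p⇒∣p-x∣<∣p∣ c∈p-a-b))) (x∈p⇒∣p-x∣<∣p∣ b∈p-a)

injection⇒∣p∣≤∣q∣ : ∀ {m m'} (p : Subset m) (q : Subset m') (R : Fin m → Fin m' → Set) →
  (∀ {x} → x ∈ p → ∃[ y ] (y ∈ q × R x y)) →
  (∀ {x x' y} → R x y → R x' y → x ≡ x') →
  ∣ p ∣ ≤ ∣ q ∣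
injection⇒∣p∣≤∣q∣ []            q R total injective = z≤n
injection⇒∣p∣≤∣q∣ (outside ∷ p) q R total injective =
  injection⇒∣p∣≤∣q∣ p q (λ x → R (suc x)) (λ x∈ → total (there x∈))
    (λ r r' → fsuc-injective (injective r r'))
injection⇒∣p∣≤∣q∣ (inside ∷ p)  q R total injective with total here
... | y₀ , y₀∈q , R0y₀ =
  ≤-trans (s≤s (injection⇒∣p∣≤∣q∣ p (q - y₀) (λ x → R (suc x)) total-q-y₀
                  (λ r r' → fsuc-injective (injective r r'))))
          (x∈p⇒∣p-x∣<∣p∣ y₀∈q)
  where
  total-q-y₀ : ∀ {x} → x ∈ p → ∃[ y ] (y ∈ q - y₀ × R (suc x) y)
  total-q-y₀ x∈ with total (there x∈)
  ... | y , y∈q , r = y , x∈p∧x≢y⇒x∈p-y y∈q (λ { refl → contradiction (injective R0y₀ r) λ () }) , r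

∣p△q∣≤∣p∣ : ∀ {m} (p q : Subset m) (R : Fin m → Fin m → Set) →
  (∀ {x} → x ∈ q → x ∉ p → ∃[ y ] (y ∈ q × y ∈ p × R x y)) →
  (∀ {x x' y} → R x y → R x' y → x ≡ x') →
  ∣ p △ q ∣ ≤ ∣ p ∣
∣p△q∣≤∣p∣ p q R matched injective = injection⇒∣p∣≤∣q∣ (p △ q) p R' total injective'
  where
  R' : Fin _ → Fin _ → Set
  R' x y = (y ≡ x × x ∉ q) ⊎ (y ∈ q × R x y)
  total : ∀ {x} → x ∈ p △ q → ∃[ y ] (y ∈ p × R' x y)
  total {x} x∈ with x∈p△q⁻ p q x∈
  ... | inj₁ (x∈p , x∉q) = x , x∈p , inj₁ (refl , x∉q)
  ... | inj₂ (x∈q , x∉p) with matched x∈q x∉p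
  ...   | y , y∈q , y∈p , r = y , y∈p , inj₂ (y∈q , r)
  injective' : ∀ {x x' y} → R' x y → R' x' y → x ≡ x'
  injective' (inj₁ (refl , _))   (inj₁ (refl , _))   = refl
  injective' (inj₁ (refl , x∉q)) (inj₂ (x∈q , _))   = contradiction x∈q x∉q
  injective' (inj₂ (x∈q , _))    (inj₁ (refl , x∉q)) = contradiction x∈q x∉q
  injective' (inj₂ (_ , r))      (inj₂ (_ , r'))     = injective r r'

⋃⁻ : ∀ {m j} (F : Fin j → Subset m) {x} → x ∈ ⋃ F → ∃[ i ] x ∈ F i
⋃⁻ {j = 0}     F x∈ = contradiction x∈ ∉⊥
⋃⁻ {j = suc j} F x∈ with x∈p∪q⁻ (F zero) (⋃ (λ i → F (suc i))) x∈
... | inj₁ x∈F₀ = zero , x∈F₀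
... | inj₂ x∈⋃ with ⋃⁻ (λ i → F (suc i)) x∈⋃
...   | i , x∈Fi = suc i , x∈Fi

⋃⁺ : ∀ {m j} (F : Fin j → Subset m) {x} i → x ∈ F i → x ∈ ⋃ F
⋃⁺ F zero    x∈ = x∈p∪q⁺ (inj₁ x∈)
⋃⁺ F (suc i) x∈ = x∈p∪q⁺ (inj₂ (⋃⁺ (λ i → F (suc i)) i x∈))

zero⊎pred : ∀ {l} (k : Fin l) → toℕ k ≡ 0 ⊎ Σ[ i ∈ Fin l ] suc (toℕ i) ≡ toℕ k
zero⊎pred zero    = inj₁ refl
zero⊎pred (suc k) = inj₂ (inject₁ k , cong suc (toℕ-inject₁ k))

last⊎next : ∀ {l} (k : Fin l) → suc (toℕ k) ≡ l ⊎ Σ[ j ∈ Fin l ] suc (toℕ k) ≡ toℕ j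
last⊎next {suc 0}       zero    = inj₁ refl
last⊎next {suc (suc l)} zero    = inj₂ (suc zero , refl)
last⊎next {suc l}       (suc k) with last⊎next k
... | inj₁ last       = inj₁ (cong suc last)
... | inj₂ (j , next) = inj₂ (suc j , cong suc next)

module GraphProperties {n m} (G : Graph n m) where
  open Graph G

  At : Fin m → Fin n → Set
  At e z = src e ≡ z ⊎ tgt e ≡ z

  degree : Subset m → Fin n → ℕ
  degree S z = ∣ incident S z ∣

  joins-sym : ∀ {e a b} → Joins e a b → Joins e b a
  joins-sym = Sum.swap

  joins⇒Atˡ : ∀ {e a b} → Joins e a b → At e a
  joins⇒Atˡ (inj₁ (s≡a , _)) = inj₁ s≡a
  joins⇒Atˡ (inj₂ (_ , t≡a)) = inj₂ t≡a

  joins⇒Atʳ : ∀ {e a b} → Joins e a b → At e b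
  joins⇒Atʳ = joins⇒Atˡ ∘ joins-sym

  At⇒joins : ∀ {e z} → At e z → ∃[ v ] Joins e z v
  At⇒joins {e} (inj₁ s≡z) = tgt e , inj₁ (s≡z , refl)
  At⇒joins {e} (inj₂ t≡z) = src e , inj₂ (refl , t≡z)

  At-joins : ∀ {e z a b} → At e z → Joins e a b → z ≡ a ⊎ z ≡ b
  At-joins (inj₁ s≡z) (inj₁ (s≡a , _)) = inj₁ (trans (sym s≡z) s≡a)
  At-joins (inj₁ s≡z) (inj₂ (s≡b , _)) = inj₂ (trans (sym s≡z) s≡b)
  At-joins (inj₂ t≡z) (inj₁ (_ , t≡b)) = inj₂ (trans (sym t≡z) t≡b)
  At-joins (inj₂ t≡z) (inj₂ (_ , t≡a)) = inj₁ (trans (sym t≡z) t≡a)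

  joins-functional : ∀ {e u v v'} → Joins e u v → Joins e u v' → v ≡ v'
  joins-functional J J' with At-joins (joins⇒Atʳ J') J
  ... | inj₂ v'≡v = sym v'≡v
  ... | inj₁ refl with At-joins (joins⇒Atʳ J) J'
  ...   | inj₁ refl = refl
  ...   | inj₂ refl = refl

  ¬joins-loop : ∀ {e z} → ¬ Joins e z z
  ¬joins-loop {e} (inj₁ (s≡z , t≡z)) = loopless e (trans s≡z (sym t≡z))
  ¬joins-loop {e} (inj₂ (s≡z , t≡z)) = loopless e (trans s≡z (sym t≡z))

  adj-sym : ∀ {S a b} → Adj S a b → Adj S b a
  adj-sym (e , e∈S , J) = e , e∈S , joins-sym J

  ∈incident⁺ : ∀ {S e z} → e ∈ S → At e z → e ∈ incident S z
  ∈incident⁺ {S} {z = z} e∈S at =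
    ∈tabulate⁺ (λ e → (e ∈? S) ×-dec ((src e ≟ᶠ z) ⊎-dec (tgt e ≟ᶠ z))) (e∈S , at)

  ∈incident⁻ : ∀ {S e z} → e ∈ incident S z → e ∈ S × At e z
  ∈incident⁻ {S} {z = z} = ∈tabulate⁻ (λ e → (e ∈? S) ×-dec ((src e ≟ᶠ z) ⊎-dec (tgt e ≟ᶠ z)))

  ∈N⁺ : ∀ {S u v} → Adj S u v → v ∈ N S u
  ∈N⁺ {S} {u} = ∈tabulate⁺ (λ v → any? (λ e → (e ∈? S) ×-dec joins? e u v))

  ∈N⁻ : ∀ {S u v} → v ∈ N S u → Adj S u v
  ∈N⁻ {S} {u} = ∈tabulate⁻ (λ v → any? (λ e → (e ∈? S) ×-dec joins? e u v))

  incident-∩ : ∀ S Q z → incident (S ∩ Q) z ≡ incident S z ∩ Q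
  incident-∩ S Q z = ⊆-antisym into onto
    where
    into : incident (S ∩ Q) z ⊆ incident S z ∩ Q
    into e∈ with ∈incident⁻ e∈
    ... | e∈S∩Q , at with x∈p∩q⁻ S Q e∈S∩Q
    ...   | e∈S , e∈Q = x∈p∩q⁺ (∈incident⁺ e∈S at , e∈Q)
    onto : incident S z ∩ Q ⊆ incident (S ∩ Q) z
    onto e∈ with x∈p∩q⁻ (incident S z) Q e∈
    ... | e∈Sz , e∈Q with ∈incident⁻ e∈Sz
    ...   | e∈S , at = ∈incident⁺ (x∈p∩q⁺ (e∈S , e∈Q)) at

  incident-─ : ∀ S Q z → incident (S ─ Q) z ≡ incident S z ─ Q
  incident-─ S Q z = ⊆-antisym into onto
    where
    into : incident (S ─ Q) z ⊆ incident S z ─ Q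
    into e∈ with ∈incident⁻ e∈
    ... | e∈S─Q , at with x∈p─q⁻ S Q e∈S─Q
    ...   | e∈S , e∉Q = x∈p∧x∉q⇒x∈p─q (∈incident⁺ e∈S at) e∉Q
    onto : incident S z ─ Q ⊆ incident (S ─ Q) z
    onto e∈ with x∈p─q⁻ (incident S z) Q e∈
    ... | e∈Sz , e∉Q with ∈incident⁻ e∈Sz
    ...   | e∈S , at = ∈incident⁺ (x∈p∧x∉q⇒x∈p─q e∈S e∉Q) at

  degree-split : ∀ S Q z → degree S z ≡ degree (S ∩ Q) z + degree (S ─ Q) z
  degree-split S Q z = begin
    ∣ incident S z ∣                            ≡⟨ ∣p∣≡∣p∩q∣+∣p─q∣ (incident S z) Q ⟩
    ∣ incident S z ∩ Q ∣ + ∣ incident S z ─ Q ∣ ≡⟨ sym (cong₂ _+_ (cong ∣_∣ (incident-∩ S Q z))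
                                                                   (cong ∣_∣ (incident-─ S Q z))) ⟩
    degree (S ∩ Q) z + degree (S ─ Q) z         ∎
    where open ≡-Reasoning

  degree≡∣N∣ : ∀ S z → degree S z ≡ ∣ N S z ∣
  degree≡∣N∣ S z = ≤-antisym
    (injection⇒∣p∣≤∣q∣ (incident S z) (N S z) (λ e v → Joins e z v) other-end
       (λ {e} {e'} {v} J J' → simple e e' z v J J'))
    (injection⇒∣p∣≤∣q∣ (N S z) (incident S z) (λ v e → Joins e z v) edge-to
       joins-functional)
    where
    other-end : ∀ {e} → e ∈ incident S z → ∃[ v ] (v ∈ N S z × Joins e z v)
    other-end e∈ with ∈incident⁻ e∈
    ... | e∈S , at with At⇒joins at
    ...   | v , J = v , ∈N⁺ (_ , e∈S , J) , J
    edge-to : ∀ {v} → v ∈ N S z → ∃[ e ] (e ∈ incident S z × Joins e z v)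
    edge-to v∈ with ∈N⁻ v∈
    ... | e , e∈S , J = e , ∈incident⁺ e∈S (joins⇒Atˡ J) , J

  distinct-neighbours⇒3≤degree : ∀ {S z a b c} → a ≢ b → b ≢ c → a ≢ c →
    Adj S z a → Adj S z b → Adj S z c → 3 ≤ degree S z
  distinct-neighbours⇒3≤degree {S} {z} a≢b b≢c a≢c za zb zc =
    subst (3 ≤_) (sym (degree≡∣N∣ S z)) (distinct³⇒3≤∣p∣ a≢b b≢c a≢c (∈N⁺ za) (∈N⁺ zb) (∈N⁺ zc))

  -- Two triangles on e with apexes w ≢ w' give both endpoints of e three distinct neighbours.
  degree≤2⇒atMostOneTriangle : ∀ {S} e → degree S (src e) ≤ 2 ⊎ degree S (tgt e) ≤ 2 →
    AtMostOneTriangle S e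
  degree≤2⇒atMostOneTriangle e small w w' (_ , y≢w , x≢w , xy , yw , xw) (_ , y≢w' , x≢w' , _ , yw' , xw')
    with w ≟ᶠ w'
  ... | yes w≡w' = w≡w'
  ... | no w≢w' = ⊥-elim ([ 1+n≰n ∘ ≤-trans (distinct-neighbours⇒3≤degree y≢w w≢w' y≢w' xy xw xw')
                          , 1+n≰n ∘ ≤-trans (distinct-neighbours⇒3≤degree x≢w w≢w' x≢w' (adj-sym xy) yw yw')
                          ] small)

  degree≤2-off⇒atMostOneTriangle : ∀ S x → (∀ z → z ≢ x → degree S z ≤ 2) →
    ∀ e → AtMostOneTriangle S e
  degree≤2-off⇒atMostOneTriangle S x small e with src e ≟ᶠ x
  ... | yes s≡x =
        degree≤2⇒atMostOneTriangle e (inj₂ (small (tgt e) λ t≡x → loopless e (trans s≡x (sym t≡x))))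
  ... | no s≢x  = degree≤2⇒atMostOneTriangle e (inj₁ (small (src e) s≢x))

module TrailProperties {n m} (G : Graph n m) where
  open Graph G
  open GraphProperties G

  edges⁺ : ∀ (P : Trail G) k → edge P k ∈ edges G P
  edges⁺ P k = ∈tabulate⁺ (λ e → any? (λ k' → edge P k' ≟ᶠ e)) (k , refl)

  edges⁻ : ∀ (P : Trail G) {e} → e ∈ edges G P → Σ[ k ∈ Fin (len P) ] edge P k ≡ e
  edges⁻ P = ∈tabulate⁻ (λ e → any? (λ k → edge P k ≟ᶠ e))

  lastNode : Trail G → Fin n
  lastNode P = node P (fromℕ (len P))

  next-node : ∀ (P : Trail G) {i j : Fin (len P)} → suc (toℕ i) ≡ toℕ j →
    node P (suc i) ≡ node P (inject₁ j)
  next-node P {j = j} i+1≡j = cong (node P) (toℕ-injective (trans i+1≡j (sym (toℕ-inject₁ j))))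

  record Step (P : Trail G) (z : Fin n) (g h : Fin m) : Set where
    constructor step
    field
      i j    : Fin (len P)
      i+1≡j  : suc (toℕ i) ≡ toℕ j
      via    : node P (suc i) ≡ z
      edge-i : edge P i ≡ g
      edge-j : edge P j ≡ h

  Link : Trail G → Fin n → Fin m → Fin m → Set
  Link P z g h = Step P z g h ⊎ Step P z h g

  data EndAt (P : Trail G) (z : Fin n) (k : Fin (len P)) : Set where
    first : toℕ k ≡ 0 → firstNode G P ≡ z → EndAt P z k
    last  : suc (toℕ k) ≡ len P → lastNode P ≡ z → EndAt P z k

  step-injectiveˡ : ∀ {P z z' g g' h} → Step P z g h → Step P z' g' h → g ≡ g'
  step-injectiveˡ {P} (step i j i+1≡j _ refl refl) (step i' _ i'+1≡j' _ refl e) =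
    cong (edge P) (toℕ-injective (suc-injective
      (trans i+1≡j (trans (cong toℕ (distinct P (sym e))) (sym i'+1≡j')))))

  step-injectiveʳ : ∀ {P z z' g h h'} → Step P z g h → Step P z' g h' → h ≡ h'
  step-injectiveʳ {P} (step i j i+1≡j _ refl refl) (step i' j' i'+1≡j' _ e refl) =
    cong (edge P) (toℕ-injective
      (trans (sym i+1≡j) (trans (cong (suc ∘ toℕ) (distinct P (sym e))) i'+1≡j')))

  -- Otherwise the edge between the two steps would be a loop at z.
  ¬Step-chain : ∀ {P z g h h'} → Step P z g h → ¬ Step P z h h'
  ¬Step-chain {P} (step _ j i+1≡j via refl refl) (step _ _ _ via' e refl) =
    ¬joins-loop (subst₂ (Joins (edge P j)) start end (consec P j))
    where
    start : node P (inject₁ j) ≡ _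
    start = trans (sym (next-node P i+1≡j)) via
    end : node P (suc j) ≡ _
    end = trans (cong (node P ∘ suc) (distinct P (sym e))) via'

  link-injective : ∀ {P z g g' h} → Link P z g h → Link P z g' h → g ≡ g'
  link-injective (inj₁ s) (inj₁ s') = step-injectiveˡ s s'
  link-injective (inj₂ s) (inj₂ s') = step-injectiveʳ s s'
  link-injective (inj₁ s) (inj₂ s') = ⊥-elim (¬Step-chain s s')
  link-injective (inj₂ s) (inj₁ s') = ⊥-elim (¬Step-chain s' s)

  link-∈edges : ∀ {P z g h} → Link P z g h → h ∈ edges G P
  link-∈edges {P} (inj₁ (step _ j _ _ _ refl)) = edges⁺ P j
  link-∈edges {P} (inj₂ (step i _ _ _ refl _)) = edges⁺ P i

  link-At : ∀ {P z g h} → Link P z g h → At h z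
  link-At {P} (inj₁ (step _ j i+1≡j refl _ refl)) =
    subst (At (edge P j)) (sym (next-node P i+1≡j)) (joins⇒Atˡ (consec P j))
  link-At {P} (inj₂ (step i _ _ refl refl _)) = joins⇒Atʳ (consec P i)

  alternating-step : ∀ {B P z g h} → Alternating G B P → Step P z g h → g ∉ B → h ∈ B
  alternating-step alt (step i j i+1≡j _ refl refl) = proj₂ (alt i j i+1≡j)

  alternating-step⁻ : ∀ {B P z g h} → Alternating G B P → Step P z g h → h ∉ B → g ∈ B
  alternating-step⁻ {B} alt (step i j i+1≡j _ refl refl) h∉B =
    decidable-stable (_ ∈? B) (λ g∉B → h∉B (proj₂ (alt i j i+1≡j) g∉B))

  alternating-link : ∀ {B P z g h} → Alternating G B P → Link P z g h → g ∉ B → h ∈ B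
  alternating-link alt (inj₁ s) = alternating-step alt s
  alternating-link alt (inj₂ s) = alternating-step⁻ alt s

  At-edge⇒link⊎end : ∀ (P : Trail G) {z} k → At (edge P k) z →
    (∃[ h ] Link P z (edge P k) h) ⊎ EndAt P z k
  At-edge⇒link⊎end P k at with At-joins at (consec P k)
  ... | inj₁ z≡start with zero⊎pred k
  ...   | inj₁ k≡0 =
          inj₂ (first k≡0 (trans (cong (node P) (toℕ-injective (sym (trans (toℕ-inject₁ k) k≡0))))
                                 (sym z≡start)))
  ...   | inj₂ (i , i+1≡k) =
          inj₁ (edge P i , inj₂ (step i k i+1≡k (trans (next-node P i+1≡k) (sym z≡start)) refl refl))
  At-edge⇒link⊎end P k at | inj₂ z≡end with last⊎next k
  ... | inj₁ k+1≡len =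
        inj₂ (last k+1≡len (trans (cong (node P) (toℕ-injective (trans (toℕ-fromℕ _) (sym k+1≡len))))
                                  (sym z≡end)))
  ... | inj₂ (j , k+1≡j) = inj₁ (edge P j , inj₁ (step k j k+1≡j (sym z≡end) refl refl))

  alternating-partner : ∀ {B} (P : Trail G) {z} k → Alternating G B P → At (edge P k) z → edge P k ∉ B →
    (∃[ h ] (h ∈ B × Link P z (edge P k) h)) ⊎ EndAt P z k
  alternating-partner P k alt at e∉B =
    Sum.map₁ (λ (h , L) → h , alternating-link alt L e∉B , L) (At-edge⇒link⊎end P k at)

  -- If the first (last) edge were in A, shifting every non-A edge of P to its predecessor
  -- (successor) would inject A △ P into A.
  augmenting-first∉ : ∀ {A} {P : Trail G} {k} → Augmenting G A P → toℕ k ≡ 0 → edge P k ∉ A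
  augmenting-first∉ {A} {P} {k} (alt , _ , grows) k≡0 k∈A =
    1+n≰n (subst (_≤ ∣ A ∣) grows (∣p△q∣≤∣p∣ A (edges G P) Precedes predecessor step-injective))
    where
    Precedes : Fin m → Fin m → Set
    Precedes e h = ∃[ z ] Step P z h e
    predecessor : ∀ {e} → e ∈ edges G P → e ∉ A → ∃[ h ] (h ∈ edges G P × h ∈ A × Precedes e h)
    predecessor e∈P e∉A with edges⁻ P e∈P
    ... | k' , refl with zero⊎pred k'
    ...   | inj₁ k'≡0 =
            contradiction (subst (λ x → edge P x ∈ A) (toℕ-injective (trans k≡0 (sym k'≡0))) k∈A) e∉A
    ...   | inj₂ (i , i+1≡k') = edge P i , edges⁺ P i , alternating-step⁻ alt s e∉A , _ , s
      where
      s : Step P (node P (suc i)) (edge P i) (edge P k')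
      s = step i k' i+1≡k' refl refl refl
    step-injective : ∀ {e e' h} → Precedes e h → Precedes e' h → e ≡ e'
    step-injective (_ , s) (_ , s') = step-injectiveʳ s s'

  augmenting-last∉ : ∀ {A} {P : Trail G} {k} → Augmenting G A P → suc (toℕ k) ≡ len P → edge P k ∉ A
  augmenting-last∉ {A} {P} {k} (alt , _ , grows) k+1≡len k∈A =
    1+n≰n (subst (_≤ ∣ A ∣) grows (∣p△q∣≤∣p∣ A (edges G P) Succeeds successor step-injective))
    where
    Succeeds : Fin m → Fin m → Set
    Succeeds e h = ∃[ z ] Step P z e h
    successor : ∀ {e} → e ∈ edges G P → e ∉ A → ∃[ h ] (h ∈ edges G P × h ∈ A × Succeeds e h)
    successor e∈P e∉A with edges⁻ P e∈P
    ... | k' , refl with last⊎next k'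
    ...   | inj₁ k'+1≡len =
            contradiction (subst (λ x → edge P x ∈ A)
              (toℕ-injective (suc-injective (trans k+1≡len (sym k'+1≡len)))) k∈A) e∉A
    ...   | inj₂ (j , k'+1≡j) = edge P j , edges⁺ P j , alternating-step alt s e∉A , _ , s
      where
      s : Step P (node P (suc k')) (edge P k') (edge P j)
      s = step k' j k'+1≡j refl refl refl
    step-injective : ∀ {e e' h} → Succeeds e h → Succeeds e' h → e ≡ e'
    step-injective (_ , s) (_ , s') = step-injectiveˡ s s'

  augmenting-end∉ : ∀ {A P z k} → Augmenting G A P → EndAt P z k → edge P k ∉ A
  augmenting-end∉ {A} {P} {k = k} aug (first k≡0 _)    = augmenting-first∉ {A} {P} {k} aug k≡0
  augmenting-end∉ {A} {P} {k = k} aug (last k+1≡len _) = augmenting-last∉ {A} {P} {k} aug k+1≡len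

  alternating-△ : ∀ {A O} {P : Trail G} → edges G P ⊆ A △ O → Alternating G A P → Alternating G O P
  alternating-△ {P = P} P⊆A△O alt i j i+1≡j =
    (λ i∈O → x∈p△q∧x∈p⇒x∉q (D j) (proj₂ (alt i j i+1≡j) (x∈p△q∧x∈q⇒x∉p (D i) i∈O))) ,
    (λ i∉O → x∈p△q∧x∉p⇒x∈q (D j) (proj₁ (alt i j i+1≡j) (x∈p△q∧x∉q⇒x∈p (D i) i∉O)))
    where
    D : ∀ k → edge P k ∈ _ △ _
    D k = P⊆A△O (edges⁺ P k)

  EdgeDisjoint : {I : Set} → (I → Trail G) → Set
  EdgeDisjoint F = ∀ i i' {e} → e ∈ edges G (F i) → e ∈ edges G (F i') → i ≡ i'

  link-injective-family : ∀ {I : Set} {F : I → Trail G} → EdgeDisjoint F →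
    ∀ {i i' z g g' h} → Link (F i) z g h → Link (F i') z g' h → g ≡ g'
  link-injective-family disjoint {i} {i'} L L' with disjoint i i' (link-∈edges L) (link-∈edges L')
  ... | refl = link-injective L L'

  -- Every edge of Q ∖ B at z is matched, inside its own trail, with a B-edge at z;
  -- only trail ends at z outside B stay unmatched, and those are charged to X.
  degree-△≤ : ∀ {I : Set} (B X Q : Subset m) (F : I → Trail G) {z} →
    EdgeDisjoint F → (∀ i → Alternating G B (F i)) →
    (∀ {e} → e ∈ Q → ∃[ i ] e ∈ edges G (F i)) → (∀ i {e} → e ∈ edges G (F i) → e ∈ Q) →
    (∀ i k → EndAt (F i) z k → edge (F i) k ∉ B → edge (F i) k ∈ X) →
    degree (B △ Q) z ≤ ∣ incident B z ∪ X ∣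
  degree-△≤ B X Q F {z} disjoint alternating Q⁻ Q⁺ ends =
    injection⇒∣p∣≤∣q∣ _ _ Image image image-injective
    where
    Image : Fin m → Fin m → Set
    Image g h = (h ≡ g × (g ∉ Q ⊎ g ∉ B)) ⊎ (h ∈ B × ∃[ i ] Link (F i) z g h)
    image : ∀ {g} → g ∈ incident (B △ Q) z → ∃[ h ] (h ∈ incident B z ∪ X × Image g h)
    image g∈ with ∈incident⁻ g∈
    ... | g∈B△Q , at with x∈p△q⁻ B Q g∈B△Q
    ...   | inj₁ (g∈B , g∉Q) = _ , x∈p∪q⁺ (inj₁ (∈incident⁺ g∈B at)) , inj₁ (refl , inj₁ g∉Q)
    ...   | inj₂ (g∈Q , g∉B) with Q⁻ g∈Q
    ...     | i , g∈Fi with edges⁻ (F i) g∈Fi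
    ...       | k , refl with alternating-partner (F i) k (alternating i) at g∉B
    ...         | inj₁ (h , h∈B , L) = h , x∈p∪q⁺ (inj₁ (∈incident⁺ h∈B (link-At L))) , inj₂ (h∈B , i , L)
    ...         | inj₂ end = _ , x∈p∪q⁺ (inj₂ (ends i k end g∉B)) , inj₁ (refl , inj₂ g∉B)
    image-injective : ∀ {g g' h} → Image g h → Image g' h → g ≡ g'
    image-injective (inj₁ (refl , _))        (inj₁ (refl , _))        = refl
    image-injective (inj₁ (refl , inj₁ g∉Q)) (inj₂ (_ , i , L))       = contradiction (Q⁺ i (link-∈edges L)) g∉Q
    image-injective (inj₁ (refl , inj₂ g∉B)) (inj₂ (h∈B , _))         = contradiction h∈B g∉B
    image-injective (inj₂ (_ , i , L))       (inj₁ (refl , inj₁ g∉Q)) = contradiction (Q⁺ i (link-∈edges L)) g∉Q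
    image-injective (inj₂ (h∈B , _))         (inj₁ (refl , inj₂ g∉B)) = contradiction h∈B g∉B
    image-injective (inj₂ (_ , _ , L))       (inj₂ (_ , _ , L'))      = link-injective-family disjoint L L'

module UniqueTriangle {n m} (G : Graph n m) (A O : Subset m)
  (A-2matching : Graph.Is2Matching G A) (O-2matching : Graph.Is2Matching G O)
  (j : ℕ) (Ps : Fin j → Trail G)
  (Ps-disjoint : ∀ i i' → i ≢ i' → Disjoint (edges G (Ps i)) (edges G (Ps i')))
  (Ps-augmenting : ∀ i → Augmenting G A (Ps i))
  (Ps⊆A△O : ∀ i → edges G (Ps i) ⊆ A △ O)
  (Pk : Trail G)
  (Pk-alternating : Alternating G A Pk)
  (Pk⊆A△O─𝒫 : edges G Pk ⊆ (A △ O) ─ ⋃ (λ i → edges G (Ps i)))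
  (Pk-starts-in-O─A : FirstEdgeIn G Pk (O ─ A))
  (deficient : Deficient G A O (⋃ (λ i → edges G (Ps i))) (firstNode G Pk))
  where

  open Graph G
  open GraphProperties G
  open TrailProperties G
  open ≤-Reasoning

  Ps-edges : Fin j → Subset m
  Ps-edges i = edges G (Ps i)

  𝒫 : Subset m
  𝒫 = ⋃ Ps-edges

  u : Fin n
  u = firstNode G Pk

  Pk-edges : Subset m
  Pk-edges = edges G Pk

  Pk⊆A△O : Pk-edges ⊆ A △ O
  Pk⊆A△O e∈ = proj₁ (x∈p─q⁻ (A △ O) 𝒫 (Pk⊆A△O─𝒫 e∈))

  Pk-avoids-𝒫 : ∀ {e} → e ∈ Pk-edges → e ∉ 𝒫
  Pk-avoids-𝒫 e∈ = proj₂ (x∈p─q⁻ (A △ O) 𝒫 (Pk⊆A△O─𝒫 e∈))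

  Ps-edgeDisjoint : EdgeDisjoint Ps
  Ps-edgeDisjoint i i' e∈ e∈' with i ≟ᶠ i'
  ... | yes i≡i' = i≡i'
  ... | no i≢i'  = ⊥-elim (Ps-disjoint i i' i≢i' _ (e∈ , e∈'))

  Ps-alternatingᴼ : ∀ i → Alternating G O (Ps i)
  Ps-alternatingᴼ i = alternating-△ {P = Ps i} (Ps⊆A△O i) (proj₁ (Ps-augmenting i))

  -- A-edges of augmenting trails are never trail ends, so each is matched with an O-edge.
  degree-A∩𝒫≤degree-O∩𝒫 : ∀ z → degree (A ∩ 𝒫) z ≤ degree (O ∩ 𝒫) z
  degree-A∩𝒫≤degree-O∩𝒫 z = injection⇒∣p∣≤∣q∣ _ _ (λ g h → ∃[ i ] Link (Ps i) z g h) partner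
    (λ (_ , L) (_ , L') → link-injective-family Ps-edgeDisjoint L L')
    where
    partner : ∀ {g} → g ∈ incident (A ∩ 𝒫) z → ∃[ h ] (h ∈ incident (O ∩ 𝒫) z × ∃[ i ] Link (Ps i) z g h)
    partner g∈ with ∈incident⁻ g∈
    ... | g∈A∩𝒫 , at with x∈p∩q⁻ A 𝒫 g∈A∩𝒫
    ...   | g∈A , g∈𝒫 with ⋃⁻ Ps-edges g∈𝒫
    ...     | i , g∈Pi with edges⁻ (Ps i) g∈Pi
    ...       | k , refl with alternating-partner (Ps i) k (Ps-alternatingᴼ i) at
                            (x∈p△q∧x∈p⇒x∉q (Ps⊆A△O i g∈Pi) g∈A)
    ...         | inj₁ (h , h∈O , L) =
                  h , ∈incident⁺ (x∈p∩q⁺ (h∈O , ⋃⁺ Ps-edges i (link-∈edges L))) (link-At L) , i , L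
    ...         | inj₂ end = contradiction g∈A (augmenting-end∉ (Ps-augmenting i) end)

  degreeA-first<2 : degree A u < 2
  degreeA-first<2 = begin-strict
    degree A u                          ≡⟨ degree-split A 𝒫 u ⟩
    degree (A ∩ 𝒫) u + degree (A ─ 𝒫) u ≤⟨ +-mono-≤ (degree-A∩𝒫≤degree-O∩𝒫 u)
                                                     (≤-reflexive (degree≡∣N∣ (A ─ 𝒫) u)) ⟩
    degree (O ∩ 𝒫) u + ∣ N (A ─ 𝒫) u ∣ <⟨ +-monoʳ-< (degree (O ∩ 𝒫) u) deficient ⟩
    degree (O ∩ 𝒫) u + ∣ N (O ─ 𝒫) u ∣ ≡⟨ cong (degree (O ∩ 𝒫) u +_) (sym (degree≡∣N∣ (O ─ 𝒫) u)) ⟩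
    degree (O ∩ 𝒫) u + degree (O ─ 𝒫) u ≡⟨ sym (degree-split O 𝒫 u) ⟩
    degree O u                          ≤⟨ O-2matching u ⟩
    2                                   ∎

  degree-A△Pk≤ : ∀ {z} X → (∀ (_ : ⊤) k → EndAt Pk z k → edge Pk k ∉ A → edge Pk k ∈ X) →
    degree (A △ Pk-edges) z ≤ ∣ incident A z ∪ X ∣
  degree-A△Pk≤ X =
    degree-△≤ A X Pk-edges (λ _ → Pk) (λ _ _ _ _ → refl) (λ _ → Pk-alternating)
      (tt ,_) (λ _ e∈ → e∈)

  degree-A△Pk≤2 : ∀ z → z ≢ lastNode Pk → degree (A △ Pk-edges) z ≤ 2
  degree-A△Pk≤2 z z≢last with z ≟ᶠ u
  ... | no z≢u = begin
    degree (A △ Pk-edges) z ≤⟨ degree-A△Pk≤ ∅ no-end ⟩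
    ∣ incident A z ∪ ∅ ∣    ≡⟨ cong ∣_∣ (∪-identityʳ (incident A z)) ⟩
    degree A z              ≤⟨ A-2matching z ⟩
    2                       ∎
    where
    no-end : ∀ _ k → EndAt Pk z k → edge Pk k ∉ A → edge Pk k ∈ ∅
    no-end _ _ (first _ first≡z) _ = contradiction (sym first≡z) z≢u
    no-end _ _ (last _ last≡z)   _ = contradiction (sym last≡z) z≢last
  ... | yes refl = begin
    degree (A △ Pk-edges) u ≤⟨ degree-A△Pk≤ ⁅ f ⁆ first-end ⟩
    ∣ incident A u ∪ ⁅ f ⁆ ∣ ≤⟨ ∣p∪q∣≤∣p∣+∣q∣ (incident A u) ⁅ f ⁆ ⟩
    degree A u + ∣ ⁅ f ⁆ ∣   ≡⟨ cong (degree A u +_) (∣⁅x⁆∣≡1 f) ⟩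
    degree A u + 1           ≤⟨ +-monoˡ-≤ 1 (s≤s⁻¹ degreeA-first<2) ⟩
    2                        ∎
    where
    k₀ : Fin (len Pk)
    k₀ = fromℕ< (proj₁ Pk-starts-in-O─A)
    f : Fin m
    f = edge Pk k₀
    first-end : ∀ _ k → EndAt Pk u k → edge Pk k ∉ A → edge Pk k ∈ ⁅ f ⁆
    first-end _ k (first k≡0 _) _ =
      subst (λ x → edge Pk x ∈ ⁅ f ⁆) (toℕ-injective (trans (toℕ-fromℕ< _) (sym k≡0))) (x∈⁅x⁆ f)
    first-end _ _ (last _ last≡u) _ = contradiction (sym last≡u) z≢last

  Trails : Fin j ⊎ ⊤ → Trail G
  Trails = [ Ps , (λ _ → Pk) ]

  Trails-edgeDisjoint : EdgeDisjoint Trails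
  Trails-edgeDisjoint (inj₁ i) (inj₁ i') e∈ e∈' = cong inj₁ (Ps-edgeDisjoint i i' e∈ e∈')
  Trails-edgeDisjoint (inj₁ i) (inj₂ _)  e∈ e∈' = contradiction (⋃⁺ Ps-edges i e∈) (Pk-avoids-𝒫 e∈')
  Trails-edgeDisjoint (inj₂ _) (inj₁ i)  e∈ e∈' = contradiction (⋃⁺ Ps-edges i e∈') (Pk-avoids-𝒫 e∈)
  Trails-edgeDisjoint (inj₂ _) (inj₂ _)  _  _   = refl

  Trails-alternatingᴼ : ∀ t → Alternating G O (Trails t)
  Trails-alternatingᴼ (inj₁ i) = Ps-alternatingᴼ i
  Trails-alternatingᴼ (inj₂ _) = alternating-△ {P = Pk} Pk⊆A△O Pk-alternating

  ∈𝒫∪Pk⁻ : ∀ {e} → e ∈ 𝒫 ∪ Pk-edges → ∃[ t ] e ∈ edges G (Trails t)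
  ∈𝒫∪Pk⁻ e∈ with x∈p∪q⁻ 𝒫 Pk-edges e∈
  ... | inj₂ e∈Pk = inj₂ tt , e∈Pk
  ... | inj₁ e∈𝒫 with ⋃⁻ Ps-edges e∈𝒫
  ...   | i , e∈Pi = inj₁ i , e∈Pi

  ∈𝒫∪Pk⁺ : ∀ t {e} → e ∈ edges G (Trails t) → e ∈ 𝒫 ∪ Pk-edges
  ∈𝒫∪Pk⁺ (inj₁ i) e∈ = x∈p∪q⁺ (inj₁ (⋃⁺ Ps-edges i e∈))
  ∈𝒫∪Pk⁺ (inj₂ _) e∈ = x∈p∪q⁺ (inj₂ e∈)

  degree-O△𝒫ₖ≤2 : ∀ z → z ≢ lastNode Pk → degree (O △ (𝒫 ∪ Pk-edges)) z ≤ 2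
  degree-O△𝒫ₖ≤2 z z≢last = begin
    degree (O △ (𝒫 ∪ Pk-edges)) z ≤⟨ degree-△≤ O ∅ (𝒫 ∪ Pk-edges) Trails Trails-edgeDisjoint
                                       Trails-alternatingᴼ ∈𝒫∪Pk⁻ ∈𝒫∪Pk⁺ ends-in-O ⟩
    ∣ incident O z ∪ ∅ ∣          ≡⟨ cong ∣_∣ (∪-identityʳ (incident O z)) ⟩
    degree O z                    ≤⟨ O-2matching z ⟩
    2                             ∎
    where
    ends-in-O : ∀ t k → EndAt (Trails t) z k → edge (Trails t) k ∉ O → edge (Trails t) k ∈ ∅
    ends-in-O (inj₁ i) k end k∉O = contradiction
      (x∈p△q∧x∉p⇒x∈q (Ps⊆A△O i (edges⁺ (Ps i) k)) (augmenting-end∉ (Ps-augmenting i) end)) k∉O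
    ends-in-O (inj₂ _) k (first k≡0 _) k∉O =
      contradiction (proj₁ (x∈p─q⁻ O A (proj₂ Pk-starts-in-O─A k k≡0))) k∉O
    ends-in-O (inj₂ _) k (last _ last≡z) _ = contradiction (sym last≡z) z≢last

corollary1 : ∀ {n m} (G : Graph n m) (APX OPT : Subset m) →
    Graph.IsTF2M G APX →
    OptFor G APX OPT →
    -- k = suc j ≥ 1; P₁ … P_{k-1} indexed by Fin j
    (j : ℕ) (Ps : Fin j → Trail G) →
    (∀ i i' → i ≢ i' → Disjoint (edges G (Ps i)) (edges G (Ps i'))) →
    (∀ i → Augmenting G APX (Ps i)) →
    (∀ i → edges G (Ps i) ⊆ (APX △ OPT)) →
    (Pk : Trail G) →
    Alternating G APX Pk →
    edges G Pk ⊆ ((APX △ OPT) ─ ⋃ (λ i → edges G (Ps i))) →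
    FirstEdgeIn G Pk (OPT ─ APX) →
    Deficient G APX OPT (⋃ (λ i → edges G (Ps i))) (firstNode G Pk) →
    ∀ e → e ∈ edges G Pk →
      Graph.AtMostOneTriangle G (APX △ edges G Pk) e
      × Graph.AtMostOneTriangle G (OPT △ (⋃ (λ i → edges G (Ps i)) ∪ edges G Pk)) e
corollary1 G APX OPT (APX-2matching , _) ((OPT-2matching , _) , _) j Ps disjoint augmenting Ps⊆ Pk
           alternating Pk⊆ starts deficient e _ =
  degree≤2-off⇒atMostOneTriangle _ (lastNode Pk) degree-A△Pk≤2 e ,
  degree≤2-off⇒atMostOneTriangle _ (lastNode Pk) degree-O△𝒫ₖ≤2 e
  where
  open GraphProperties G
  open TrailProperties G
  open UniqueTriangle G APX OPT APX-2matching OPT-2matching j Ps disjoint augmenting Ps⊆ Pk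
                      alternating Pk⊆ starts deficient
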